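{- Let $\ell$ be a positive integer coprime to $3$, let $q=2^m$ with $m$ a positive integer, and let $\Gamma_\ell$ be the set of roots in $\mathbb{F}_{q^3}$ of $X^{2q^\ell+1}+X+1$ and $N_\ell:=|\Gamma_\ell|$. Then $N_\ell=3$ if $3\mid m(\ell-m)$, and $N_\ell=0$ otherwise. Moreover, if $3\mid m$ then $\Gamma_\ell$ is the set of roots of $X^3+X+1$, and if $\ell\equiv m\equiv\pm1\pmod 3$ then $\Gamma_\ell$ is the set of roots of $X^3+X^2+1$. -}

module Defs where

open import Level using (Level; _⊔_)
open import Data.Nat using (ℕ; zero; suc)
open import Data.Fin using (Fin)
open import Data.Product using (∃; _×_)
open import Relation.Nullary using (¬_)
open import Relation.Binary.PropositionalEquality using (_≡_)
open import Algebra.Bundles using (CommutativeRing)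

record IsField {c ℓ : Level} (F : CommutativeRing c ℓ) : Set (c ⊔ ℓ) where
  open CommutativeRing F
  field
    0≉1     : ¬ (0# ≈ 1#)
    inverse : ∀ x → ¬ (x ≈ 0#) → ∃ λ y → (x * y) ≈ 1#

record HasCardinality {c ℓ : Level} (F : CommutativeRing c ℓ) (n : ℕ) : Set (c ⊔ ℓ) where
  open CommutativeRing F
  field
    enum       : Fin n → Carrier
    injective  : ∀ i j → enum i ≈ enum j → i ≡ j
    surjective : ∀ x → ∃ λ i → enum i ≈ x

module _ {c ℓ : Level} (F : CommutativeRing c ℓ) where
  open CommutativeRing F

  pow : Carrier → ℕ → Carrier
  pow x zero    = 1#
  pow x (suc k) = x * pow x k

  HasExactly : (Carrier → Set ℓ) → ℕ → Set (c ⊔ ℓ)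
  HasExactly S k =
    ∃ λ (e : Fin k → Carrier) →
      (∀ i → S (e i)) × (∀ i j → e i ≈ e j → i ≡ j) × (∀ x → S x → ∃ λ i → e i ≈ x)

  Γ : ℕ → ℕ → Carrier → Set ℓ
  Γ m l x = (pow x (2 ℕ.* (2 ℕ.^ m) ℕ.^ l ℕ.+ 1) + x + 1#) ≈ 0#
    where import Data.Nat as ℕ

  RootA : Carrier → Set ℓ
  RootA x = (pow x 3 + x + 1#) ≈ 0#

  RootB : Carrier → Set ℓ
  RootB x = (pow x 3 + pow x 2 + 1#) ≈ 0#

{-# OPTIONS --safe #-}
-- Let q = 2^m and φ x = x^(q^ℓ). Since |F| = q³ is even, F has characteristic 2, so φ
-- is a ring endomorphism, and φ³ = id because x^|F| = x. A root x of X^(2q^ℓ+1) + X + 1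
-- satisfies x (φx + 1)² = 1; applying φ twice gives x (y + 1)² = y (z + 1)² = z (x + 1)² = 1,
-- which forces x^8 = x. On 𝔽₈ the map φ is x ↦ x^(2^r) with r = mℓ mod 3, which turns the
-- equation into X³ + X + 1 (r = 0), (X² + X + 1)(X³ + X² + 1) (r = 1) or X² + X + 1 (r = 2),
-- and X² + X + 1 has no root in 𝔽₈. Each cubic has the three roots a, a², a⁴ as soon as it
-- has a root a, and a root exists because 7 divides |F| - 1: some power y of a unit satisfies
-- y⁷ = 1 ≠ y, so y is a root of one of the cubics and y⁻¹ of the other. Finally, as 3 ∤ ℓ,
-- 3 divides m(ℓ - m) exactly when mℓ ≢ 2 (mod 3).

module Submission where

open import Defs
open import Level using (Level; 0ℓ; _⊔_)
open import Algebra.Bundles using (CommutativeRing; RawRing)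
open import Algebra.Solver.Ring.AlmostCommutativeRing
  using (fromCommutativeRing; _-Raw-AlmostCommutative⟶_; Induced-equivalence)
open import Data.Bool using (Bool; true; false)
open import Data.Bool.Properties using (xor-∧-commutativeRing) renaming (_≟_ to _≟𝔹_)
open import Data.Empty using (⊥-elim)
open import Data.Fin using (Fin; zero; suc; punchIn; punchOut; inject≤)
import Data.Fin.Properties as Fin
open import Data.Fin.Permutation using (Permutation; permutation)
open import Data.Maybe using (just; nothing)
open import Data.Nat as ℕ using (ℕ; zero; suc)
import Data.Nat.Properties as ℕ
import Data.Nat.Divisibility as ND
open import Data.Product using (∃; _×_; _,_; proj₁; proj₂)
open import Data.Sum as Sum using (_⊎_; inj₁; inj₂; [_,_])
open import Data.Vec using (Vec; []; _∷_)
open import Data.Vec.Relation.Unary.All using (All; []; _∷_)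
import Data.Vec.Functional as Vector
open import Function.Base using (_∘_)
open import Function.Bundles using (_⇔_; mk⇔; Equivalence)
open import Function.Properties.Equivalence using () renaming (sym to ⇔-sym; trans to ⇔-trans)
open import Relation.Binary.Definitions using (Decidable; WeaklyDecidable)
open import Relation.Binary.PropositionalEquality as ≡ using (_≡_; _≢_)
open import Relation.Nullary using (¬_; yes; no)
import Relation.Nullary.Decidable as Dec

⇔-assuming : ∀ {a b c} {A : Set a} {B : Set b} {C : Set c} →
             (A → C) → (B → C) → (C → A ⇔ B) → A ⇔ B
⇔-assuming A⇒C B⇒C A⇔B = mk⇔ (λ a → Equivalence.to (A⇔B (A⇒C a)) a)
                              (λ b → Equivalence.from (A⇔B (B⇒C b)) b)

module RingLemmas {c ℓ : Level} (R : CommutativeRing c ℓ) where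
  open CommutativeRing R hiding (zero)
  open import Algebra.Properties.CommutativeSemiring.Exp commutativeSemiring public
  open import Algebra.Solver.Ring.NaturalCoefficients.Default commutativeSemiring
  open import Relation.Binary.Reasoning.Setoid setoid

  ^-swap : ∀ x m n → (x ^ m) ^ n ≈ (x ^ n) ^ m
  ^-swap x m n = begin
    (x ^ m) ^ n      ≈⟨ ^-assocʳ x m n ⟩
    x ^ (m ℕ.* n)    ≡⟨ ≡.cong (x ^_) (ℕ.*-comm m n) ⟩
    x ^ (n ℕ.* m)    ≈⟨ ^-assocʳ x n m ⟨
    (x ^ n) ^ m      ∎

  1^n≈1 : ∀ n → 1# ^ n ≈ 1#
  1^n≈1 zero    = refl
  1^n≈1 (suc n) = trans (*-identityˡ _) (1^n≈1 n)

  ≈-decidable : ∀ {n} → HasCardinality R n → Decidable _≈_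
  ≈-decidable {n} card x y = Dec.map′ index-≡⇒≈ ≈⇒index-≡ (index x Fin.≟ index y)
    where
    open HasCardinality card
    index : Carrier → Fin n
    index z = proj₁ (surjective z)
    index-≡⇒≈ : index x ≡ index y → x ≈ y
    index-≡⇒≈ eq = begin
      x                ≈⟨ proj₂ (surjective x) ⟨
      enum (index x)   ≡⟨ ≡.cong enum eq ⟩
      enum (index y)   ≈⟨ proj₂ (surjective y) ⟩
      y                ∎
    ≈⇒index-≡ : x ≈ y → index x ≡ index y
    ≈⇒index-≡ x≈y = injective _ _ (begin
      enum (index x)   ≈⟨ proj₂ (surjective x) ⟩
      x                ≈⟨ x≈y ⟩
      y                ≈⟨ proj₂ (surjective y) ⟨
      enum (index y)   ∎)

  pow≈^ : ∀ x n → pow R x n ≈ x ^ n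
  pow≈^ x zero    = refl
  pow≈^ x (suc n) = *-congˡ (pow≈^ x n)

  ≈0-⇔ : ∀ {x y} → x ≈ y → (x ≈ 0# ⇔ y ≈ 0#)
  ≈0-⇔ x≈y = mk⇔ (trans (sym x≈y)) (trans x≈y)

  Distinct : ∀ {n} → (Fin n → Carrier) → Set ℓ
  Distinct xs = ∀ i j → xs i ≈ xs j → i ≡ j

  ∷-distinct : ∀ {n x} {xs : Fin n → Carrier} →
               (∀ i → ¬ xs i ≈ x) → Distinct xs → Distinct (x Vector.∷ xs)
  ∷-distinct new distinct zero    zero    _  = ≡.refl
  ∷-distinct new distinct zero    (suc j) eq = ⊥-elim (new j (sym eq))
  ∷-distinct new distinct (suc i) zero    eq = ⊥-elim (new i eq)
  ∷-distinct new distinct (suc i) (suc j) eq = ≡.cong suc (distinct i j eq)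

  HasExactly-⇔ : ∀ {S T : Carrier → Set ℓ} {n} →
                 (∀ x → S x ⇔ T x) → HasExactly R T n → HasExactly R S n
  HasExactly-⇔ S⇔T (e , T-e , e-distinct , e-complete) =
    e , (λ i → Equivalence.from (S⇔T (e i)) (T-e i)) , e-distinct ,
    (λ x Sx → e-complete x (Equivalence.to (S⇔T x) Sx))

  HasExactly-∅ : ∀ {S : Carrier → Set ℓ} → (∀ x → ¬ S x) → HasExactly R S 0
  HasExactly-∅ ¬S = (λ ()) , (λ ()) , (λ ()) , (λ x Sx → ⊥-elim (¬S x Sx))

  -- Polynomials are coefficient vectors, constant term first.
  eval : ∀ {n} → Vec Carrier n → Carrier → Carrier
  eval []      x = 0#
  eval (b ∷ p) x = b + x * eval p x

  eval-cong : ∀ {n} (p : Vec Carrier n) {x y} → x ≈ y → eval p x ≈ eval p y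
  eval-cong []      x≈y = refl
  eval-cong (b ∷ p) x≈y = +-congˡ (*-cong x≈y (eval-cong p x≈y))

  Xⁿ : ∀ n → Vec Carrier (suc n)
  Xⁿ zero    = 1# ∷ []
  Xⁿ (suc n) = 0# ∷ Xⁿ n

  eval-Xⁿ : ∀ n x → eval (Xⁿ n) x ≈ x ^ n
  eval-Xⁿ zero    x = trans (+-congˡ (zeroʳ x)) (+-identityʳ 1#)
  eval-Xⁿ (suc n) x = trans (+-identityˡ _) (*-congˡ (eval-Xⁿ n x))

  quotient : ∀ {n} → Carrier → Vec Carrier (suc n) → Vec Carrier n
  quotient a (b ∷ [])        = []
  quotient a (b ∷ p@(_ ∷ _)) = eval p a ∷ quotient a p

  -- p(x) - p(a) = (x - a) q(x), written without subtraction.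
  eval-quotient : ∀ {n} a (p : Vec Carrier (suc n)) x →
                  eval p x + a * eval (quotient a p) x ≈ x * eval (quotient a p) x + eval p a
  eval-quotient a (b ∷ []) x =
    solve 3 (λ a b x → (b :+ x :* con 0) :+ a :* con 0 := x :* con 0 :+ (b :+ a :* con 0)) refl a b x
  eval-quotient a (b ∷ p@(_ ∷ _)) x = begin
    (b + x * P) + a * (Pa + x * Q)   ≈⟨ solve 6 (λ a b x P Pa Q →
                                          (b :+ x :* P) :+ a :* (Pa :+ x :* Q)
                                          := (b :+ a :* Pa) :+ x :* (P :+ a :* Q)) refl a b x P Pa Q ⟩
    (b + a * Pa) + x * (P + a * Q)   ≈⟨ +-congˡ (*-congˡ (eval-quotient a p x)) ⟩
    (b + a * Pa) + x * (x * Q + Pa)  ≈⟨ solve 5 (λ a b x Pa Q →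
                                          (b :+ a :* Pa) :+ x :* (x :* Q :+ Pa)
                                          := x :* (Pa :+ x :* Q) :+ (b :+ a :* Pa)) refl a b x Pa Q ⟩
    x * (Pa + x * Q) + (b + a * Pa)  ∎
    where
    P Pa Q : Carrier
    P  = eval p x
    Pa = eval p a
    Q  = eval (quotient a p) x

HasCharacteristic2 : ∀ {c ℓ} → CommutativeRing c ℓ → Set (c ⊔ ℓ)
HasCharacteristic2 R = ∀ x → x + x ≈ 0#
  where open CommutativeRing R

module Characteristic2 {c ℓ : Level} (R : CommutativeRing c ℓ) (x+x≈0 : HasCharacteristic2 R) where
  open CommutativeRing R hiding (zero)
  open RingLemmas R
  open import Algebra.Properties.AbelianGroup +-abelianGroup using (ε⁻¹≈ε; inverseˡ-unique)
  open import Relation.Binary.Reasoning.Setoid setoid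

  -- A ring of characteristic 2 is an 𝔽₂-algebra, so polynomial identities
  -- can be normalised with coefficients in 𝔽₂.
  𝔽₂ : RawRing 0ℓ 0ℓ
  𝔽₂ = CommutativeRing.rawRing xor-∧-commutativeRing

  ⟦_⟧₂ : Bool → Carrier
  ⟦ false ⟧₂ = 0#
  ⟦ true  ⟧₂ = 1#

  𝔽₂⟶R : 𝔽₂ -Raw-AlmostCommutative⟶ fromCommutativeRing R
  𝔽₂⟶R = record
    { ⟦_⟧    = ⟦_⟧₂
    ; +-homo = λ { false _ → sym (+-identityˡ _) ; true false → sym (+-identityʳ 1#)
                 ; true true → sym (x+x≈0 1#) }
    ; *-homo = λ { false _ → sym (zeroˡ _) ; true _ → sym (*-identityˡ _) }
    ; -‿homo = λ { false → sym ε⁻¹≈ε ; true → inverseˡ-unique 1# 1# (x+x≈0 1#) }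
    ; 0-homo = refl
    ; 1-homo = refl
    }

  𝔽₂-≟ : WeaklyDecidable (Induced-equivalence 𝔽₂⟶R)
  𝔽₂-≟ a b with a ≟𝔹 b
  ... | yes ≡.refl = just refl
  ... | no  _      = nothing

  open import Algebra.Solver.Ring 𝔽₂ (fromCommutativeRing R) 𝔽₂⟶R 𝔽₂-≟ public
    using (solve; _:=_; con; _:+_; _:*_; _:^_)

  pattern 𝟘 = con false
  pattern 𝟙 = con true

  x+y≈0⇒x≈y : ∀ {x y} → x + y ≈ 0# → x ≈ y
  x+y≈0⇒x≈y {x} {y} x+y≈0 = begin
    x            ≈⟨ solve 2 (λ x y → x := (x :+ y) :+ y) refl x y ⟩
    (x + y) + y  ≈⟨ +-congʳ x+y≈0 ⟩
    0# + y       ≈⟨ +-identityˡ y ⟩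
    y            ∎

  x≈y⇒x+y≈0 : ∀ {x y} → x ≈ y → x + y ≈ 0#
  x≈y⇒x+y≈0 {y = y} x≈y = trans (+-congʳ x≈y) (x+x≈0 y)

  ^2^-homo-+ : ∀ j x y → (x + y) ^ (2 ℕ.^ j) ≈ x ^ (2 ℕ.^ j) + y ^ (2 ℕ.^ j)
  ^2^-homo-+ zero    x y = solve 2 (λ x y → (x :+ y) :^ 1 := x :^ 1 :+ y :^ 1) refl x y
  ^2^-homo-+ (suc j) x y = begin
    (x + y) ^ (2 ℕ.* e)              ≈⟨ ^-assocʳ (x + y) 2 e ⟨
    ((x + y) ^ 2) ^ e                ≈⟨ ^-congˡ e (solve 2 (λ x y → (x :+ y) :^ 2 := x :^ 2 :+ y :^ 2) refl x y) ⟩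
    (x ^ 2 + y ^ 2) ^ e              ≈⟨ ^2^-homo-+ j (x ^ 2) (y ^ 2) ⟩
    (x ^ 2) ^ e + (y ^ 2) ^ e        ≈⟨ +-cong (^-assocʳ x 2 e) (^-assocʳ y 2 e) ⟩
    x ^ (2 ℕ.* e) + y ^ (2 ℕ.* e)    ∎
    where
    e : ℕ
    e = 2 ℕ.^ j

  ^2^-mod3 : ∀ {x} → x ^ 8 ≈ x → ∀ k → x ^ (2 ℕ.^ k) ≈ x ^ (2 ℕ.^ (k ℕ.% 3))
  ^2^-mod3 x⁸≈x 0 = refl
  ^2^-mod3 x⁸≈x 1 = refl
  ^2^-mod3 x⁸≈x 2 = refl
  ^2^-mod3 {x} x⁸≈x (suc (suc (suc k))) = begin
    x ^ (2 ℕ.^ (3 ℕ.+ k))      ≡⟨ ≡.cong (x ^_) (ℕ.^-distribˡ-+-* 2 3 k) ⟩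
    x ^ (8 ℕ.* 2 ℕ.^ k)        ≈⟨ ^-assocʳ x 8 (2 ℕ.^ k) ⟨
    (x ^ 8) ^ (2 ℕ.^ k)        ≈⟨ ^-congˡ (2 ℕ.^ k) x⁸≈x ⟩
    x ^ (2 ℕ.^ k)              ≈⟨ ^2^-mod3 x⁸≈x k ⟩
    x ^ (2 ℕ.^ (k ℕ.% 3))      ∎

  eval-^2 : ∀ {n} {p : Vec Carrier n} → All (λ b → b ^ 2 ≈ b) p →
            ∀ x → eval p (x ^ 2) ≈ eval p x ^ 2
  eval-^2 []                    x = sym (zeroˡ _)
  eval-^2 {p = b ∷ p} (b²≈b ∷ idem) x = begin
    b + x ^ 2 * eval p (x ^ 2)    ≈⟨ +-cong (sym b²≈b) (*-congˡ (eval-^2 idem x)) ⟩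
    b ^ 2 + x ^ 2 * eval p x ^ 2
      ≈⟨ solve 3 (λ b x e → b :^ 2 :+ x :^ 2 :* e :^ 2 := (b :+ x :* e) :^ 2) refl b x (eval p x) ⟩
    (b + x * eval p x) ^ 2        ∎

  eval-^2-root : ∀ {n} {p : Vec Carrier n} → All (λ b → b ^ 2 ≈ b) p →
                 ∀ {x} → eval p x ≈ 0# → eval p (x ^ 2) ≈ 0#
  eval-^2-root idem {x} root = trans (eval-^2 idem x) (trans (^-congˡ 2 root) (zeroˡ _))

  infix 4 _↝_
  _↝_ : Carrier → Carrier → Set ℓ
  u ↝ v = u * (v + 1#) ^ 2 ≈ 1#

  ↝-congʳ : ∀ {u v w} → v ≈ w → u ↝ v → u ↝ w
  ↝-congʳ v≈w = trans (*-congˡ (^-congˡ 2 (+-congʳ (sym v≈w))))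

  ↝⇔≈0 : ∀ {u v p} → u * (v + 1#) ^ 2 + 1# ≈ p → (u ↝ v ⇔ p ≈ 0#)
  ↝⇔≈0 eq = mk⇔ (λ u↝v → trans (sym eq) (x≈y⇒x+y≈0 u↝v)) (λ p≈0 → x+y≈0⇒x≈y (trans eq p≈0))

  Γ-equation⇔↝ : ∀ e x → (pow R x (2 ℕ.* e ℕ.+ 1) + x + 1# ≈ 0#) ⇔ x ↝ x ^ e
  Γ-equation⇔↝ e x = ⇔-sym (↝⇔≈0 (begin
    x * (x ^ e + 1#) ^ 2 + 1#
      ≈⟨ solve 2 (λ x w → x :* (w :+ 𝟙) :^ 2 :+ 𝟙 := x :* w :^ 2 :+ x :+ 𝟙) refl x (x ^ e) ⟩
    x * (x ^ e) ^ 2 + x + 1#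
      ≈⟨ +-congʳ (+-congʳ (*-congˡ (^-assocʳ x e 2))) ⟩
    x * x ^ (e ℕ.* 2) + x + 1#
      ≡⟨ ≡.cong (λ n → x ^ n + x + 1#) (≡.trans (≡.cong suc (ℕ.*-comm e 2)) (ℕ.+-comm 1 (2 ℕ.* e))) ⟩
    x ^ (2 ℕ.* e ℕ.+ 1) + x + 1#
      ≈⟨ +-congʳ (+-congʳ (pow≈^ x (2 ℕ.* e ℕ.+ 1))) ⟨
    pow R x (2 ℕ.* e ℕ.+ 1) + x + 1#   ∎))

  ↝-^2^ : ∀ j {u v} → u ↝ v → u ^ (2 ℕ.^ j) ↝ v ^ (2 ℕ.^ j)
  ↝-^2^ j {u} {v} u↝v = begin
    u ^ e * (v ^ e + 1#) ^ 2       ≈⟨ *-congˡ (^-congˡ 2 (+-congˡ (sym (1^n≈1 e)))) ⟩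
    u ^ e * (v ^ e + 1# ^ e) ^ 2   ≈⟨ *-congˡ (^-congˡ 2 (^2^-homo-+ j v 1#)) ⟨
    u ^ e * ((v + 1#) ^ e) ^ 2     ≈⟨ *-congˡ (^-swap (v + 1#) e 2) ⟩
    u ^ e * ((v + 1#) ^ 2) ^ e     ≈⟨ ^-distrib-* u ((v + 1#) ^ 2) e ⟨
    (u * (v + 1#) ^ 2) ^ e         ≈⟨ ^-congˡ e u↝v ⟩
    1# ^ e                         ≈⟨ 1^n≈1 e ⟩
    1#                             ∎
    where
    e : ℕ
    e = 2 ℕ.^ j

  -- u ↝ v says u = 1 / (v + 1)². The map u ↦ 1 / (u + 1) has order 3 over 𝔽₂ and
  -- commutes with squaring, so going round the cycle gives x = x^8.
  ↝-cycle : ∀ {x y z} → x ↝ y → y ↝ z → z ↝ x → x ^ 8 ≈ x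
  ↝-cycle {x} {y} {z} x↝y y↝z z↝x = begin
    x ^ 8                           ≈⟨ *-identityʳ _ ⟨
    x ^ 8 * 1#                      ≈⟨ *-congˡ x↝y ⟨
    x ^ 8 * (x * (y + 1#) ^ 2)
      ≈⟨ solve 2 (λ x y → x :^ 8 :* (x :* (y :+ 𝟙) :^ 2) := x :* ((y :+ 𝟙) :* x :^ 4) :^ 2) refl x y ⟩
    x * ((y + 1#) * x ^ 4) ^ 2      ≈⟨ *-congˡ (^-congˡ 2 [y+1]x⁴≈1) ⟩
    x * 1# ^ 2                      ≈⟨ solve 1 (λ x → x :* 𝟙 :^ 2 := x) refl x ⟩
    x                               ∎
    where
    [z+1][x+1]²≈x² : (z + 1#) * (x + 1#) ^ 2 ≈ x ^ 2
    [z+1][x+1]²≈x² = begin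
      (z + 1#) * (x + 1#) ^ 2
        ≈⟨ solve 2 (λ x z → (z :+ 𝟙) :* (x :+ 𝟙) :^ 2 := z :* (x :+ 𝟙) :^ 2 :+ 𝟙 :+ x :^ 2) refl x z ⟩
      z * (x + 1#) ^ 2 + 1# + x ^ 2  ≈⟨ +-congʳ (+-congʳ z↝x) ⟩
      1# + 1# + x ^ 2                ≈⟨ solve 1 (λ x → 𝟙 :+ 𝟙 :+ x :^ 2 := x :^ 2) refl x ⟩
      x ^ 2                          ∎
    yx⁴≈[x+1]⁴ : y * x ^ 4 ≈ (x + 1#) ^ 4
    yx⁴≈[x+1]⁴ = begin
      y * x ^ 4                               ≈⟨ solve 2 (λ x y → y :* x :^ 4 := y :* (x :^ 2) :^ 2) refl x y ⟩
      y * (x ^ 2) ^ 2                         ≈⟨ *-congˡ (^-congˡ 2 [z+1][x+1]²≈x²) ⟨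
      y * ((z + 1#) * (x + 1#) ^ 2) ^ 2
        ≈⟨ solve 3 (λ x y z → y :* ((z :+ 𝟙) :* (x :+ 𝟙) :^ 2) :^ 2 := y :* (z :+ 𝟙) :^ 2 :* (x :+ 𝟙) :^ 4) refl x y z ⟩
      y * (z + 1#) ^ 2 * (x + 1#) ^ 4         ≈⟨ *-congʳ y↝z ⟩
      1# * (x + 1#) ^ 4                       ≈⟨ *-identityˡ _ ⟩
      (x + 1#) ^ 4                            ∎
    [y+1]x⁴≈1 : (y + 1#) * x ^ 4 ≈ 1#
    [y+1]x⁴≈1 = begin
      (y + 1#) * x ^ 4            ≈⟨ solve 2 (λ x y → (y :+ 𝟙) :* x :^ 4 := y :* x :^ 4 :+ x :^ 4) refl x y ⟩
      y * x ^ 4 + x ^ 4           ≈⟨ +-congʳ yx⁴≈[x+1]⁴ ⟩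
      (x + 1#) ^ 4 + x ^ 4        ≈⟨ solve 1 (λ x → (x :+ 𝟙) :^ 4 :+ x :^ 4 := 𝟙) refl x ⟩
      1#                          ∎

  x⁷+1≈[x+1][x³+x+1][x³+x²+1] : ∀ x →
    x ^ 7 + 1# ≈ (x + 1#) * ((x ^ 3 + x + 1#) * (x ^ 3 + x ^ 2 + 1#))
  x⁷+1≈[x+1][x³+x+1][x³+x²+1] =
    solve 1 (λ x → x :^ 7 :+ 𝟙 := (x :+ 𝟙) :* ((x :^ 3 :+ x :+ 𝟙) :* (x :^ 3 :+ x :^ 2 :+ 𝟙))) refl

module FieldLemmas {c ℓ : Level} (F : CommutativeRing c ℓ) (isField : IsField F)
                   (_≟_ : Decidable (CommutativeRing._≈_ F)) where
  open CommutativeRing F hiding (zero)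
  open IsField isField
  open RingLemmas F
  open import Algebra.Properties.Ring ring using (-1*x≈-x)
  open import Algebra.Properties.AbelianGroup +-abelianGroup using (⁻¹-involutive)
  open import Relation.Binary.Reasoning.Setoid setoid

  1≉0 : ¬ 1# ≈ 0#
  1≉0 1≈0 = 0≉1 (sym 1≈0)

  *-cancelˡ-≉0 : ∀ {x y z} → ¬ x ≈ 0# → x * y ≈ x * z → y ≈ z
  *-cancelˡ-≉0 {x} {y} {z} x≉0 xy≈xz = begin
    y              ≈⟨ *-identityˡ y ⟨
    1# * y         ≈⟨ *-congʳ (trans (*-comm x⁻¹ x) x*x⁻¹≈1) ⟨
    x⁻¹ * x * y    ≈⟨ *-assoc x⁻¹ x y ⟩
    x⁻¹ * (x * y)  ≈⟨ *-congˡ xy≈xz ⟩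
    x⁻¹ * (x * z)  ≈⟨ *-assoc x⁻¹ x z ⟨
    x⁻¹ * x * z    ≈⟨ *-congʳ (trans (*-comm x⁻¹ x) x*x⁻¹≈1) ⟩
    1# * z         ≈⟨ *-identityˡ z ⟩
    z              ∎
    where
    x⁻¹ : Carrier
    x⁻¹ = proj₁ (inverse x x≉0)
    x*x⁻¹≈1 : x * x⁻¹ ≈ 1#
    x*x⁻¹≈1 = proj₂ (inverse x x≉0)

  ≉0*≈0⇒≈0 : ∀ {x y} → ¬ x ≈ 0# → x * y ≈ 0# → y ≈ 0#
  ≉0*≈0⇒≈0 {x} x≉0 xy≈0 = *-cancelˡ-≉0 x≉0 (trans xy≈0 (sym (zeroʳ x)))

  *-≉0 : ∀ {x y} → ¬ x ≈ 0# → ¬ y ≈ 0# → ¬ x * y ≈ 0#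
  *-≉0 x≉0 y≉0 xy≈0 = y≉0 (≉0*≈0⇒≈0 x≉0 xy≈0)

  *-≈0 : ∀ {x y} → x * y ≈ 0# → x ≈ 0# ⊎ y ≈ 0#
  *-≈0 {x} xy≈0 with x ≟ 0#
  ... | yes x≈0 = inj₁ x≈0
  ... | no  x≉0 = inj₂ (≉0*≈0⇒≈0 x≉0 xy≈0)

  x*z≈y*z⇒z≈0 : ∀ {x y z} → ¬ x ≈ y → x * z ≈ y * z → z ≈ 0#
  x*z≈y*z⇒z≈0 {x} {y} {z} x≉y xz≈yz with z ≟ 0#
  ... | yes z≈0 = z≈0
  ... | no  z≉0 = ⊥-elim (x≉y (*-cancelˡ-≉0 z≉0 (trans (*-comm z x) (trans xz≈yz (*-comm y z)))))

  roots-vanish : ∀ {n} (p : Vec Carrier n) (xs : Fin n → Carrier) → Distinct xs →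
                 (∀ i → eval p (xs i) ≈ 0#) → ∀ x → eval p x ≈ 0#
  roots-vanish []      xs distinct roots x = refl
  roots-vanish (b ∷ p) xs distinct roots x = begin
    eval (b ∷ p) x                      ≈⟨ +-identityʳ _ ⟨
    eval (b ∷ p) x + 0#                 ≈⟨ +-congˡ (trans (*-congˡ (Q≈0 x)) (zeroʳ a)) ⟨
    eval (b ∷ p) x + a * Q x            ≈⟨ eval-quotient a (b ∷ p) x ⟩
    x * Q x + eval (b ∷ p) a            ≈⟨ +-cong (trans (*-congˡ (Q≈0 x)) (zeroʳ x)) (roots zero) ⟩
    0# + 0#                             ≈⟨ +-identityˡ 0# ⟩
    0#                                  ∎
    where
    a : Carrier
    a = xs zero
    Q : Carrier → Carrier
    Q = eval (quotient a (b ∷ p))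
    Q-roots : ∀ i → Q (xs (suc i)) ≈ 0#
    Q-roots i = x*z≈y*z⇒z≈0 (λ y≈a → Fin.0≢1+n (≡.sym (distinct (suc i) zero y≈a))) (begin
      y * Q y                     ≈⟨ +-identityʳ _ ⟨
      y * Q y + 0#                ≈⟨ +-congˡ (roots zero) ⟨
      y * Q y + eval (b ∷ p) a    ≈⟨ eval-quotient a (b ∷ p) y ⟨
      eval (b ∷ p) y + a * Q y    ≈⟨ +-congʳ (roots (suc i)) ⟩
      0# + a * Q y                ≈⟨ +-identityˡ _ ⟩
      a * Q y                     ∎)
      where
      y : Carrier
      y = xs (suc i)
    Q≈0 : ∀ x → Q x ≈ 0#
    Q≈0 = roots-vanish (quotient a (b ∷ p)) (xs ∘ suc) (λ i j eq → Fin.suc-injective (distinct (suc i) (suc j) eq)) Q-roots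

  HasExactly-roots : ∀ {n} (p : Vec Carrier (suc n)) → ¬ (∀ x → eval p x ≈ 0#) →
                     (xs : Fin n → Carrier) → Distinct xs → (∀ i → eval p (xs i) ≈ 0#) →
                     HasExactly F (λ x → eval p x ≈ 0#) n
  HasExactly-roots p p≢0 xs distinct roots = xs , roots , distinct , complete
    where
    complete : ∀ x → eval p x ≈ 0# → ∃ λ i → xs i ≈ x
    complete x root with Fin.any? (λ i → xs i ≟ x)
    ... | yes found = found
    ... | no  new   = ⊥-elim (p≢0 (roots-vanish p (x Vector.∷ xs)
                        (∷-distinct (λ i xsi≈x → new (i , xsi≈x)) distinct)
                        (λ { zero → root ; (suc i) → roots i })))

  module Finite {n : ℕ} (card : HasCardinality F (suc n)) where
    open HasCardinality card
    open import Algebra.Properties.CommutativeMonoid.Sum *-commutativeMonoid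
      using (sum-permute; sum-cong-≋; ∑-distrib-+; sum-replicate) renaming (sum to ∏)

    private
      index₀ : Fin (suc n)
      index₀ = proj₁ (surjective 0#)

    unit : Fin n → Carrier
    unit i = enum (punchIn index₀ i)

    unit≉0 : ∀ i → ¬ unit i ≈ 0#
    unit≉0 i uᵢ≈0 = Fin.punchInᵢ≢i index₀ i (injective _ _ (trans uᵢ≈0 (sym (proj₂ (surjective 0#)))))

    unit-distinct : Distinct unit
    unit-distinct i j uᵢ≈uⱼ = Fin.punchIn-injective index₀ i j (injective _ _ uᵢ≈uⱼ)

    unit-surjective : ∀ {x} → ¬ x ≈ 0# → ∃ λ i → unit i ≈ x
    unit-surjective {x} x≉0 = punchOut index₀≢iₓ , (begin
      enum (punchIn index₀ (punchOut index₀≢iₓ))  ≡⟨ ≡.cong enum (Fin.punchIn-punchOut index₀≢iₓ) ⟩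
      enum (proj₁ (surjective x))                 ≈⟨ proj₂ (surjective x) ⟩
      x                                           ∎)
      where
      index₀≢iₓ : index₀ ≢ proj₁ (surjective x)
      index₀≢iₓ eq = x≉0 (begin
        x                            ≈⟨ proj₂ (surjective x) ⟨
        enum (proj₁ (surjective x))  ≡⟨ ≡.cong enum eq ⟨
        enum index₀                  ≈⟨ proj₂ (surjective 0#) ⟩
        0#                           ∎)

    ∏-≉0 : ∀ {k} (f : Fin k → Carrier) → (∀ i → ¬ f i ≈ 0#) → ¬ ∏ f ≈ 0#
    ∏-≉0 {zero}  f f≉0 = 1≉0
    ∏-≉0 {suc k} f f≉0 = *-≉0 (f≉0 zero) (∏-≉0 (f ∘ suc) (f≉0 ∘ suc))

    -- Multiplication by a permutes the units, so their product Π satisfies Π = aⁿ Π.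
    unit-fermat : ∀ {a} → ¬ a ≈ 0# → a ^ n ≈ 1#
    unit-fermat {a} a≉0 = sym (*-cancelˡ-≉0 (∏-≉0 unit unit≉0) (begin
      ∏ unit * 1#                       ≈⟨ *-identityʳ _ ⟩
      ∏ unit                            ≈⟨ sum-permute unit π ⟩
      ∏ (unit ∘ scale a≉0)              ≈⟨ sum-cong-≋ (scale-unit a≉0) ⟩
      ∏ (λ i → a * unit i)              ≈⟨ ∑-distrib-+ (λ _ → a) unit ⟩
      ∏ {n} (λ _ → a) * ∏ unit          ≈⟨ *-congʳ (sum-replicate n) ⟩
      a ^ n * ∏ unit                    ≈⟨ *-comm _ _ ⟩
      ∏ unit * a ^ n                    ∎))
      where
      a⁻¹ : Carrier
      a⁻¹ = proj₁ (inverse a a≉0)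
      aa⁻¹≈1 : a * a⁻¹ ≈ 1#
      aa⁻¹≈1 = proj₂ (inverse a a≉0)
      a⁻¹≉0 : ¬ a⁻¹ ≈ 0#
      a⁻¹≉0 a⁻¹≈0 = 1≉0 (trans (sym aa⁻¹≈1) (trans (*-congˡ a⁻¹≈0) (zeroʳ a)))
      scale : ∀ {b} → ¬ b ≈ 0# → Fin n → Fin n
      scale b≉0 i = proj₁ (unit-surjective (*-≉0 b≉0 (unit≉0 i)))
      scale-unit : ∀ {b} (b≉0 : ¬ b ≈ 0#) i → unit (scale b≉0 i) ≈ b * unit i
      scale-unit b≉0 i = proj₂ (unit-surjective (*-≉0 b≉0 (unit≉0 i)))
      scale-inverse : ∀ {b d} (b≉0 : ¬ b ≈ 0#) (d≉0 : ¬ d ≈ 0#) → b * d ≈ 1# →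
                      ∀ i → scale b≉0 (scale d≉0 i) ≡ i
      scale-inverse {b} {d} b≉0 d≉0 bd≈1 i = unit-distinct _ _ (begin
        unit (scale b≉0 (scale d≉0 i))  ≈⟨ scale-unit b≉0 _ ⟩
        b * unit (scale d≉0 i)          ≈⟨ *-congˡ (scale-unit d≉0 i) ⟩
        b * (d * unit i)                ≈⟨ *-assoc b d _ ⟨
        b * d * unit i                  ≈⟨ *-congʳ bd≈1 ⟩
        1# * unit i                     ≈⟨ *-identityˡ _ ⟩
        unit i                          ∎)
      π : Permutation n n
      π = permutation (scale a≉0) (scale a⁻¹≉0) (scale-inverse a≉0 a⁻¹≉0 aa⁻¹≈1)
                      (scale-inverse a⁻¹≉0 a≉0 (trans (*-comm a⁻¹ a) aa⁻¹≈1))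

    fermat : ∀ x → x ^ suc n ≈ x
    fermat x with x ≟ 0#
    ... | yes x≈0 = trans (*-congʳ x≈0) (trans (zeroˡ _) (sym x≈0))
    ... | no  x≉0 = trans (*-congˡ (unit-fermat x≉0)) (*-identityʳ x)

    fermat-iterate : ∀ t x → x ^ (suc n ℕ.^ t) ≈ x
    fermat-iterate zero    x = *-identityʳ x
    fermat-iterate (suc t) x = begin
      x ^ (suc n ℕ.* suc n ℕ.^ t)   ≈⟨ ^-assocʳ x (suc n) (suc n ℕ.^ t) ⟨
      (x ^ suc n) ^ (suc n ℕ.^ t)   ≈⟨ ^-congˡ (suc n ℕ.^ t) (fermat x) ⟩
      x ^ (suc n ℕ.^ t)             ≈⟨ fermat-iterate t x ⟩
      x                             ∎

    -- (-1)^|F| = -1 and, for even |F|, (-1)^|F| = 1.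
    even-card⇒x+x≈0 : 2 ND.∣ suc n → HasCharacteristic2 F
    even-card⇒x+x≈0 (ND.divides N |F|≡N*2) x = begin
      x + x                  ≈⟨ +-cong (*-identityʳ x) (*-identityʳ x) ⟨
      x * 1# + x * 1#        ≈⟨ distribˡ x 1# 1# ⟨
      x * (1# + 1#)          ≈⟨ *-congˡ (+-congˡ -1≈1) ⟨
      x * (1# + - 1#)        ≈⟨ *-congˡ (-‿inverseʳ 1#) ⟩
      x * 0#                 ≈⟨ zeroʳ x ⟩
      0#                     ∎
      where
      [-1]²≈1 : (- 1#) ^ 2 ≈ 1#
      [-1]²≈1 = trans (*-congˡ (*-identityʳ (- 1#))) (trans (-1*x≈-x (- 1#)) (⁻¹-involutive 1#))
      -1≈1 : - 1# ≈ 1#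
      -1≈1 = begin
        - 1#                   ≈⟨ fermat (- 1#) ⟨
        (- 1#) ^ suc n         ≡⟨ ≡.cong ((- 1#) ^_) (≡.trans |F|≡N*2 (ℕ.*-comm N 2)) ⟩
        (- 1#) ^ (2 ℕ.* N)     ≈⟨ ^-assocʳ (- 1#) 2 N ⟨
        ((- 1#) ^ 2) ^ N       ≈⟨ ^-congˡ N [-1]²≈1 ⟩
        1# ^ N                 ≈⟨ 1^n≈1 N ⟩
        1#                     ∎

  module WithCharacteristic2 (x+x≈0 : HasCharacteristic2 F) where
    open Characteristic2 F x+x≈0

    ^2≈0⇒≈0 : ∀ {x} → x ^ 2 ≈ 0# → x ≈ 0#
    ^2≈0⇒≈0 {x} x²≈0 = [ (λ x≈0 → x≈0) , (λ x*1≈0 → trans (sym (*-identityʳ x)) x*1≈0) ] (*-≈0 x²≈0)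

    ^2-injective : ∀ {x y} → x ^ 2 ≈ y ^ 2 → x ≈ y
    ^2-injective {x} {y} x²≈y² = x+y≈0⇒x≈y (^2≈0⇒≈0 (begin
      (x + y) ^ 2      ≈⟨ ^2^-homo-+ 1 x y ⟩
      x ^ 2 + y ^ 2    ≈⟨ x≈y⇒x+y≈0 x²≈y² ⟩
      0#               ∎))

    ^2≈x⇒0∨1 : ∀ {x} → x ^ 2 ≈ x → x ≈ 0# ⊎ x ≈ 1#
    ^2≈x⇒0∨1 {x} x²≈x = Sum.map₂ x+y≈0⇒x≈y (*-≈0 (begin
      x * (x + 1#)     ≈⟨ solve 1 (λ x → x :* (x :+ 𝟙) := x :^ 2 :+ x) refl x ⟩
      x ^ 2 + x        ≈⟨ x≈y⇒x+y≈0 x²≈x ⟩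
      0#               ∎))

    orbit : Carrier → Fin 3 → Carrier
    orbit a = a Vector.∷ a ^ 2 Vector.∷ (a ^ 2) ^ 2 Vector.∷ Vector.[]

    orbit-distinct : ∀ {a} → a ^ 8 ≈ a → ¬ a ^ 2 ≈ a → Distinct (orbit a)
    orbit-distinct {a} a⁸≈a a²≉a = ∷-distinct a-new (∷-distinct a²-new (∷-distinct (λ ()) (λ ())))
      where
      a²-new : ∀ i → ¬ ((a ^ 2) ^ 2 Vector.∷ Vector.[]) i ≈ a ^ 2
      a²-new zero a⁴≈a² = a²≉a (^2-injective a⁴≈a²)
      a-new : ∀ i → ¬ (a ^ 2 Vector.∷ (a ^ 2) ^ 2 Vector.∷ Vector.[]) i ≈ a
      a-new zero       a²≈a = a²≉a a²≈a
      a-new (suc zero) a⁴≈a = a²≉a (sym (begin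
        a                    ≈⟨ a⁸≈a ⟨
        a ^ 8                ≈⟨ solve 1 (λ a → a :^ 8 := ((a :^ 2) :^ 2) :^ 2) refl a ⟩
        ((a ^ 2) ^ 2) ^ 2    ≈⟨ ^-congˡ 2 a⁴≈a ⟩
        a ^ 2                ∎))

    -- A cubic with coefficients in 𝔽₂ and a root a ∈ 𝔽₈ ∖ 𝔽₂ has exactly the roots a, a², a⁴.
    cubic-roots : (S : Carrier → Set ℓ) (p : Vec Carrier 4) → (∀ x → S x ⇔ eval p x ≈ 0#) →
                  All (λ b → b ^ 2 ≈ b) p → ¬ S 0# → ¬ S 1# →
                  ∀ {a} → S a → a ^ 8 ≈ a → HasExactly F S 3
    cubic-roots S p S⇔root idem ¬S0 ¬S1 {a} Sa a⁸≈a =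
      HasExactly-⇔ S⇔root (HasExactly-roots p (λ vanishes → ¬S0 (Equivalence.from (S⇔root 0#) (vanishes 0#)))
                                             (orbit a) (orbit-distinct a⁸≈a a²≉a) roots)
      where
      root : eval p a ≈ 0#
      root = Equivalence.to (S⇔root a) Sa
      S-cong : ∀ {x y} → x ≈ y → S x → S y
      S-cong x≈y Sx = Equivalence.from (S⇔root _) (trans (eval-cong p (sym x≈y)) (Equivalence.to (S⇔root _) Sx))
      a²≉a : ¬ a ^ 2 ≈ a
      a²≉a a²≈a = [ (λ a≈0 → ¬S0 (S-cong a≈0 Sa)) , (λ a≈1 → ¬S1 (S-cong a≈1 Sa)) ] (^2≈x⇒0∨1 a²≈a)
      roots : ∀ i → eval p (orbit a i) ≈ 0#
      roots zero             = root
      roots (suc zero)       = eval-^2-root idem root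
      roots (suc (suc zero)) = eval-^2-root idem (eval-^2-root idem root)

    x²+x+1≉0 : ∀ {x} → x ^ 8 ≈ x → ¬ x ^ 2 + x + 1# ≈ 0#
    x²+x+1≉0 {x} x⁸≈x x²+x+1≈0 = 1≉0 (begin
      1#                ≈⟨ solve 1 (λ x → 𝟙 := x :+ x :+ 𝟙) refl x ⟩
      x + x + 1#        ≈⟨ +-congʳ (+-congʳ x≈x²) ⟩
      x ^ 2 + x + 1#    ≈⟨ x²+x+1≈0 ⟩
      0#                ∎)
      where
      x³≈1 : x ^ 3 ≈ 1#
      x³≈1 = x+y≈0⇒x≈y (begin
        x ^ 3 + 1#                     ≈⟨ solve 1 (λ x → x :^ 3 :+ 𝟙 := (x :+ 𝟙) :* (x :^ 2 :+ x :+ 𝟙)) refl x ⟩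
        (x + 1#) * (x ^ 2 + x + 1#)    ≈⟨ *-congˡ x²+x+1≈0 ⟩
        (x + 1#) * 0#                  ≈⟨ zeroʳ _ ⟩
        0#                             ∎)
      x≈x² : x ≈ x ^ 2
      x≈x² = begin
        x                      ≈⟨ x⁸≈x ⟨
        x ^ 8                  ≈⟨ solve 1 (λ x → x :^ 8 := (x :^ 3) :^ 2 :* x :^ 2) refl x ⟩
        (x ^ 3) ^ 2 * x ^ 2    ≈⟨ *-congʳ (^-congˡ 2 x³≈1) ⟩
        1# ^ 2 * x ^ 2         ≈⟨ solve 1 (λ x → 𝟙 :^ 2 :* x :^ 2 := x :^ 2) refl x ⟩
        x ^ 2                  ∎

    x↝x⇔RootA : ∀ {x} → x ↝ x ^ 1 ⇔ RootA F x
    x↝x⇔RootA {x} = ↝⇔≈0 (solve 1 (λ x → x :* (x :^ 1 :+ 𝟙) :^ 2 :+ 𝟙 := x :^ 3 :+ x :+ 𝟙) refl x)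

    x↝x²⇔RootB : ∀ {x} → x ^ 8 ≈ x → (x ↝ x ^ 2 ⇔ RootB F x)
    x↝x²⇔RootB {x} x⁸≈x = ⇔-trans
      (↝⇔≈0 (solve 1 (λ x → x :* (x :^ 2 :+ 𝟙) :^ 2 :+ 𝟙 := (x :^ 2 :+ x :+ 𝟙) :* (x :^ 3 :+ x :^ 2 :+ 𝟙)) refl x))
      (mk⇔ (≉0*≈0⇒≈0 (x²+x+1≉0 x⁸≈x)) (λ x³+x²+1≈0 → trans (*-congˡ x³+x²+1≈0) (zeroʳ _)))

    ¬x↝x⁴ : ∀ {x} → x ^ 8 ≈ x → ¬ x ↝ x ^ 4
    ¬x↝x⁴ {x} x⁸≈x = x²+x+1≉0 x⁸≈x ∘ Equivalence.to (↝⇔≈0 (begin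
      x * (x ^ 4 + 1#) ^ 2 + 1#    ≈⟨ solve 1 (λ x → x :* (x :^ 4 :+ 𝟙) :^ 2 :+ 𝟙 := x :^ 8 :* x :+ x :+ 𝟙) refl x ⟩
      x ^ 8 * x + x + 1#           ≈⟨ +-congʳ (+-congʳ (*-congʳ x⁸≈x)) ⟩
      x * x + x + 1#               ≈⟨ solve 1 (λ x → x :* x :+ x :+ 𝟙 := x :^ 2 :+ x :+ 𝟙) refl x ⟩
      x ^ 2 + x + 1#               ∎))

    x⁷≈1⇒x⁸≈x : ∀ {x} → x ^ 7 ≈ 1# → x ^ 8 ≈ x
    x⁷≈1⇒x⁸≈x {x} x⁷≈1 = trans (*-congˡ x⁷≈1) (*-identityʳ x)

    RootA⊎RootB⇒x⁷≈1 : ∀ {x} → RootA F x ⊎ RootB F x → x ^ 7 ≈ 1#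
    RootA⊎RootB⇒x⁷≈1 {x} root = x+y≈0⇒x≈y (begin
      x ^ 7 + 1#                                             ≈⟨ x⁷+1≈[x+1][x³+x+1][x³+x²+1] x ⟩
      (x + 1#) * ((x ^ 3 + x + 1#) * (x ^ 3 + x ^ 2 + 1#))   ≈⟨ *-congˡ product≈0 ⟩
      (x + 1#) * 0#                                          ≈⟨ zeroʳ _ ⟩
      0#                                                     ∎)
      where
      product≈0 : (x ^ 3 + x + 1#) * (x ^ 3 + x ^ 2 + 1#) ≈ 0#
      product≈0 = [ (λ rA → trans (*-congʳ rA) (zeroˡ _)) , (λ rB → trans (*-congˡ rB) (zeroʳ _)) ] root

    x⁷≈1⇒RootA⊎RootB : ∀ {x} → x ^ 7 ≈ 1# → ¬ x ≈ 1# → RootA F x ⊎ RootB F x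
    x⁷≈1⇒RootA⊎RootB {x} x⁷≈1 x≉1 =
      *-≈0 (≉0*≈0⇒≈0 (x≉1 ∘ x+y≈0⇒x≈y) (trans (sym (x⁷+1≈[x+1][x³+x+1][x³+x²+1] x)) (x≈y⇒x+y≈0 x⁷≈1)))

    RootA-reciprocal : ∀ {x y} → x * y ≈ 1# → RootA F x → RootB F y
    RootA-reciprocal {x} {y} xy≈1 rA = begin
      y ^ 3 + y ^ 2 + 1#
        ≈⟨ solve 2 (λ x y → y :^ 3 :+ y :^ 2 :+ 𝟙
                            := y :^ 3 :* (x :^ 3 :+ x :+ 𝟙) :+ ((x :* y) :^ 3 :+ 𝟙) :+ y :^ 2 :* (x :* y :+ 𝟙)) refl x y ⟩
      y ^ 3 * (x ^ 3 + x + 1#) + ((x * y) ^ 3 + 1#) + y ^ 2 * (x * y + 1#)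
        ≈⟨ +-cong (+-cong (*-congˡ rA) (+-congʳ (^-congˡ 3 xy≈1))) (*-congˡ (+-congʳ xy≈1)) ⟩
      y ^ 3 * 0# + (1# ^ 3 + 1#) + y ^ 2 * (1# + 1#)
        ≈⟨ solve 1 (λ y → y :^ 3 :* 𝟘 :+ (𝟙 :^ 3 :+ 𝟙) :+ y :^ 2 :* (𝟙 :+ 𝟙) := 𝟘) refl y ⟩
      0#  ∎

    RootB-reciprocal : ∀ {x y} → x * y ≈ 1# → RootB F x → RootA F y
    RootB-reciprocal {x} {y} xy≈1 rB = begin
      y ^ 3 + y + 1#
        ≈⟨ solve 2 (λ x y → y :^ 3 :+ y :+ 𝟙
                            := y :^ 3 :* (x :^ 3 :+ x :^ 2 :+ 𝟙) :+ ((x :* y) :^ 3 :+ 𝟙) :+ y :* ((x :* y) :^ 2 :+ 𝟙)) refl x y ⟩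
      y ^ 3 * (x ^ 3 + x ^ 2 + 1#) + ((x * y) ^ 3 + 1#) + y * ((x * y) ^ 2 + 1#)
        ≈⟨ +-cong (+-cong (*-congˡ rB) (+-congʳ (^-congˡ 3 xy≈1))) (*-congˡ (+-congʳ (^-congˡ 2 xy≈1))) ⟩
      y ^ 3 * 0# + (1# ^ 3 + 1#) + y * (1# ^ 2 + 1#)
        ≈⟨ solve 1 (λ y → y :^ 3 :* 𝟘 :+ (𝟙 :^ 3 :+ 𝟙) :+ y :* (𝟙 :^ 2 :+ 𝟙) := 𝟘) refl y ⟩
      0#  ∎

    RootA-and-RootB : ∀ {x} → x ^ 7 ≈ 1# → ¬ x ≈ 1# → ∃ (RootA F) × ∃ (RootB F)
    RootA-and-RootB {x} x⁷≈1 x≉1 with x⁷≈1⇒RootA⊎RootB x⁷≈1 x≉1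
    ... | inj₁ rA = (x , rA) , (x ^ 6 , RootA-reciprocal x⁷≈1 rA)
    ... | inj₂ rB = (x ^ 6 , RootB-reciprocal x⁷≈1 rB) , (x , rB)

    1²≈1 : 1# ^ 2 ≈ 1#
    1²≈1 = 1^n≈1 2

    0²≈0 : 0# ^ 2 ≈ 0#
    0²≈0 = zeroˡ (0# * 1#)

    X³+X+1 X³+X²+1 : Vec Carrier 4
    X³+X+1  = 1# ∷ 1# ∷ 0# ∷ 1# ∷ []
    X³+X²+1 = 1# ∷ 0# ∷ 1# ∷ 1# ∷ []

    RootA⇔root : ∀ x → RootA F x ⇔ eval X³+X+1 x ≈ 0#
    RootA⇔root x =
      ≈0-⇔ (solve 1 (λ x → x :^ 3 :+ x :+ 𝟙 := 𝟙 :+ x :* (𝟙 :+ x :* (𝟘 :+ x :* (𝟙 :+ x :* 𝟘)))) refl x)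

    RootB⇔root : ∀ x → RootB F x ⇔ eval X³+X²+1 x ≈ 0#
    RootB⇔root x =
      ≈0-⇔ (solve 1 (λ x → x :^ 3 :+ x :^ 2 :+ 𝟙 := 𝟙 :+ x :* (𝟘 :+ x :* (𝟙 :+ x :* (𝟙 :+ x :* 𝟘)))) refl x)

    ∃RootA⇒exactly-3 : ∃ (RootA F) → HasExactly F (RootA F) 3
    ∃RootA⇒exactly-3 (a , rA) =
      cubic-roots (RootA F) X³+X+1 RootA⇔root (1²≈1 ∷ 1²≈1 ∷ 0²≈0 ∷ 1²≈1 ∷ [])
        (1≉0 ∘ trans (solve 0 (𝟙 := 𝟘 :^ 3 :+ 𝟘 :+ 𝟙) refl))
        (1≉0 ∘ trans (solve 0 (𝟙 := 𝟙 :^ 3 :+ 𝟙 :+ 𝟙) refl))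
        rA (x⁷≈1⇒x⁸≈x (RootA⊎RootB⇒x⁷≈1 (inj₁ rA)))

    ∃RootB⇒exactly-3 : ∃ (RootB F) → HasExactly F (RootB F) 3
    ∃RootB⇒exactly-3 (a , rB) =
      cubic-roots (RootB F) X³+X²+1 RootB⇔root (1²≈1 ∷ 0²≈0 ∷ 1²≈1 ∷ 1²≈1 ∷ [])
        (1≉0 ∘ trans (solve 0 (𝟙 := 𝟘 :^ 3 :+ 𝟘 :^ 2 :+ 𝟙) refl))
        (1≉0 ∘ trans (solve 0 (𝟙 := 𝟙 :^ 3 :+ 𝟙 :^ 2 :+ 𝟙) refl))
        rB (x⁷≈1⇒x⁸≈x (RootA⊎RootB⇒x⁷≈1 (inj₂ rB)))

    module _ {g : ℕ} (card : HasCardinality F (suc (suc g ℕ.* 7))) where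
      open Finite card

      -- X^(g+1) + 1 has at most g + 1 roots, but there are 7(g + 1) units.
      unit^[g+1]≉1 : ∃ λ i → ¬ unit i ^ suc g ≈ 1#
      unit^[g+1]≉1 = Fin.¬∀⟶∃¬ _ _ (λ i → (unit i ^ suc g) ≟ 1#) (λ all-roots → 1≉0 (begin
        1#                      ≈⟨ +-identityʳ 1# ⟨
        1# + 0#                 ≈⟨ +-congˡ (zeroˡ _) ⟨
        eval X^[g+1]+1 0#       ≈⟨ roots-vanish X^[g+1]+1 (unit ∘ inject) inject-distinct (roots all-roots) 0# ⟩
        0#                      ∎))
        where
        X^[g+1]+1 : Vec Carrier (suc (suc g))
        X^[g+1]+1 = 1# ∷ Xⁿ g
        g+2≤7[g+1] : suc (suc g) ℕ.≤ suc g ℕ.* 7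
        g+2≤7[g+1] = ℕ.s≤s (ℕ.s≤s (ℕ.≤-trans (ℕ.m≤m*n g 7) (ℕ.m≤n+m _ 5)))
        inject : Fin (suc (suc g)) → Fin (suc g ℕ.* 7)
        inject i = inject≤ i g+2≤7[g+1]
        inject-distinct : Distinct (unit ∘ inject)
        inject-distinct i j eq = Fin.inject≤-injective _ _ i j (unit-distinct _ _ eq)
        roots : (∀ i → unit i ^ suc g ≈ 1#) → ∀ i → eval X^[g+1]+1 (unit (inject i)) ≈ 0#
        roots all-roots i = begin
          1# + u * eval (Xⁿ g) u    ≈⟨ +-congˡ (*-congˡ (eval-Xⁿ g u)) ⟩
          1# + u ^ suc g            ≈⟨ +-congˡ (all-roots (inject i)) ⟩
          1# + 1#                   ≈⟨ x+x≈0 1# ⟩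
          0#                        ∎
          where
          u : Carrier
          u = unit (inject i)

      roots-exist : ∃ (RootA F) × ∃ (RootB F)
      roots-exist with unit^[g+1]≉1
      ... | i , uᵢ^[g+1]≉1 =
        RootA-and-RootB (trans (^-assocʳ (unit i) (suc g) 7) (unit-fermat (unit≉0 i))) uᵢ^[g+1]≉1

    module Classification (k : ℕ) (φ³≈id : ∀ x → ((x ^ (2 ℕ.^ k)) ^ (2 ℕ.^ k)) ^ (2 ℕ.^ k) ≈ x) where
      φ : Carrier → Carrier
      φ x = x ^ (2 ℕ.^ k)

      ↝φ⇒x⁸≈x : ∀ {x} → x ↝ φ x → x ^ 8 ≈ x
      ↝φ⇒x⁸≈x {x} x↝φx = ↝-cycle x↝φx φx↝φ²x (↝-congʳ (φ³≈id x) (↝-^2^ k φx↝φ²x))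
        where
        φx↝φ²x : φ x ↝ φ (φ x)
        φx↝φ²x = ↝-^2^ k x↝φx

      ↝φ⇔↝x^2^r : ∀ {x r} → x ^ 8 ≈ x → k ℕ.% 3 ≡ r → (x ↝ φ x ⇔ x ↝ x ^ (2 ℕ.^ r))
      ↝φ⇔↝x^2^r x⁸≈x ≡.refl = mk⇔ (↝-congʳ (^2^-mod3 x⁸≈x k)) (↝-congʳ (sym (^2^-mod3 x⁸≈x k)))

      ↝φ⇔RootA : k ℕ.% 3 ≡ 0 → ∀ x → x ↝ φ x ⇔ RootA F x
      ↝φ⇔RootA k≡0 x = ⇔-assuming ↝φ⇒x⁸≈x (x⁷≈1⇒x⁸≈x ∘ RootA⊎RootB⇒x⁷≈1 ∘ inj₁)
        (λ x⁸≈x → ⇔-trans (↝φ⇔↝x^2^r x⁸≈x k≡0) x↝x⇔RootA)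

      ↝φ⇔RootB : k ℕ.% 3 ≡ 1 → ∀ x → x ↝ φ x ⇔ RootB F x
      ↝φ⇔RootB k≡1 x = ⇔-assuming ↝φ⇒x⁸≈x (x⁷≈1⇒x⁸≈x ∘ RootA⊎RootB⇒x⁷≈1 ∘ inj₂)
        (λ x⁸≈x → ⇔-trans (↝φ⇔↝x^2^r x⁸≈x k≡1) (x↝x²⇔RootB x⁸≈x))

      ¬↝φ : k ℕ.% 3 ≡ 2 → ∀ x → ¬ x ↝ φ x
      ¬↝φ k≡2 x x↝φx = ¬x↝x⁴ x⁸≈x (Equivalence.to (↝φ⇔↝x^2^r x⁸≈x k≡2) x↝φx)
        where
        x⁸≈x : x ^ 8 ≈ x
        x⁸≈x = ↝φ⇒x⁸≈x x↝φx

q³≡8^m : ∀ m → (2 ℕ.^ m) ℕ.^ 3 ≡ 8 ℕ.^ m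
q³≡8^m m = ≡.trans (ℕ.^-*-assoc 2 m 3) (≡.trans (≡.cong (2 ℕ.^_) (ℕ.*-comm m 3)) (≡.sym (ℕ.^-*-assoc 2 3 m)))

8^[1+m]≡1+[1+g]*7 : ∀ m → ∃ λ g → 8 ℕ.^ suc m ≡ suc (suc g ℕ.* 7)
8^[1+m]≡1+[1+g]*7 zero    = 0 , ≡.refl
8^[1+m]≡1+[1+g]*7 (suc m) with 8^[1+m]≡1+[1+g]*7 m
... | g , 8^[1+m]≡ = 8 ℕ.+ 8 ℕ.* g , ≡.trans (≡.cong (8 ℕ.*_) 8^[1+m]≡)
  (solve 1 (λ g → con 8 :* (con 1 :+ (con 1 :+ g) :* con 7) := con 1 :+ (con 1 :+ (con 8 :+ con 8 :* g)) :* con 7) ≡.refl g)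
  where
  open import Data.Nat.Solver using (module +-*-Solver)
  open +-*-Solver

2∣q³ : ∀ m → 2 ND.∣ (2 ℕ.^ suc m) ℕ.^ 3
2∣q³ m = ND.∣-trans (ND.m∣m*n (2 ℕ.^ m)) (ND.m∣m*n ((2 ℕ.^ suc m) ℕ.^ 2))

-- The m of the statement is suc m here.
module Corollary {c ℓ : Level} (F : CommutativeRing c ℓ) (isField : IsField F) (m l : ℕ)
                 (card : HasCardinality F ((2 ℕ.^ suc m) ℕ.^ 3)) where
  open CommutativeRing F hiding (zero)
  open RingLemmas F
  open FieldLemmas F isField (≈-decidable card)
  open ≡.≡-Reasoning

  g : ℕ
  g = proj₁ (8^[1+m]≡1+[1+g]*7 m)

  |F|≡1+[1+g]*7 : (2 ℕ.^ suc m) ℕ.^ 3 ≡ suc (suc g ℕ.* 7)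
  |F|≡1+[1+g]*7 = ≡.trans (q³≡8^m (suc m)) (proj₂ (8^[1+m]≡1+[1+g]*7 m))

  card′ : HasCardinality F (suc (suc g ℕ.* 7))
  card′ = ≡.subst (HasCardinality F) |F|≡1+[1+g]*7 card

  open Finite card′

  x+x≈0 : HasCharacteristic2 F
  x+x≈0 = even-card⇒x+x≈0 (≡.subst (2 ND.∣_) |F|≡1+[1+g]*7 (2∣q³ m))

  open Characteristic2 F x+x≈0 using (_↝_; Γ-equation⇔↝)
  open WithCharacteristic2 x+x≈0

  k : ℕ
  k = suc m ℕ.* l

  -- φ = (_^ q^l) with q = 2^(m+1), and φ³ = (_^ |F|^l) is the identity.
  φ³≈id : ∀ x → ((x ^ (2 ℕ.^ k)) ^ (2 ℕ.^ k)) ^ (2 ℕ.^ k) ≈ x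
  φ³≈id x = trans (^-assocʳ (x ^ e) e e) (trans (^-assocʳ x e (e ℕ.* e)) (trans (^-congʳ x e³≡|F|^l) (fermat-iterate l x)))
    where
    e : ℕ
    e = 2 ℕ.^ k
    e³≡|F|^l : e ℕ.* (e ℕ.* e) ≡ suc (suc g ℕ.* 7) ℕ.^ l
    e³≡|F|^l = begin
      e ℕ.* (e ℕ.* e)                   ≡⟨ ≡.cong (λ n → e ℕ.* (e ℕ.* n)) (ℕ.*-identityʳ e) ⟨
      e ℕ.^ 3                           ≡⟨ ℕ.^-*-assoc 2 k 3 ⟩
      2 ℕ.^ (k ℕ.* 3)                   ≡⟨ ≡.cong (2 ℕ.^_) (ℕ.*-assoc (suc m) l 3) ⟩
      2 ℕ.^ (suc m ℕ.* (l ℕ.* 3))       ≡⟨ ≡.cong (λ n → 2 ℕ.^ (suc m ℕ.* n)) (ℕ.*-comm l 3) ⟩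
      2 ℕ.^ (suc m ℕ.* (3 ℕ.* l))       ≡⟨ ≡.cong (2 ℕ.^_) (ℕ.*-assoc (suc m) 3 l) ⟨
      2 ℕ.^ (suc m ℕ.* 3 ℕ.* l)         ≡⟨ ℕ.^-*-assoc 2 (suc m ℕ.* 3) l ⟨
      (2 ℕ.^ (suc m ℕ.* 3)) ℕ.^ l       ≡⟨ ≡.cong (ℕ._^ l) (ℕ.^-*-assoc 2 (suc m) 3) ⟨
      ((2 ℕ.^ suc m) ℕ.^ 3) ℕ.^ l       ≡⟨ ≡.cong (ℕ._^ l) |F|≡1+[1+g]*7 ⟩
      suc (suc g ℕ.* 7) ℕ.^ l           ∎

  open Classification k φ³≈id

  Γ⇔↝φ : ∀ x → Γ F (suc m) l x ⇔ x ↝ φ x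
  Γ⇔↝φ x = ≡.subst (λ e → Γ F (suc m) l x ⇔ x ↝ x ^ e) (ℕ.^-*-assoc 2 (suc m) l)
                   (Γ-equation⇔↝ ((2 ℕ.^ suc m) ℕ.^ l) x)

  Γ⇔RootA : k ℕ.% 3 ≡ 0 → ∀ x → Γ F (suc m) l x ⇔ RootA F x
  Γ⇔RootA k≡0 x = ⇔-trans (Γ⇔↝φ x) (↝φ⇔RootA k≡0 x)

  Γ⇔RootB : k ℕ.% 3 ≡ 1 → ∀ x → Γ F (suc m) l x ⇔ RootB F x
  Γ⇔RootB k≡1 x = ⇔-trans (Γ⇔↝φ x) (↝φ⇔RootB k≡1 x)

  ¬Γ : k ℕ.% 3 ≡ 2 → ∀ x → ¬ Γ F (suc m) l x
  ¬Γ k≡2 x = ¬↝φ k≡2 x ∘ Equivalence.to (Γ⇔↝φ x)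

  RootA-has-3 : HasExactly F (RootA F) 3
  RootA-has-3 = ∃RootA⇒exactly-3 (proj₁ (roots-exist {g} card′))

  RootB-has-3 : HasExactly F (RootB F) 3
  RootB-has-3 = ∃RootB⇒exactly-3 (proj₂ (roots-exist {g} card′))

open import Data.Nat using (ℕ; _*_; _^_; _%_; _≤_)
open import Data.Nat.Coprimality using (Coprime)
open import Data.Nat.DivMod using (_/_; m≡m%n+[m/n]*n; %-distribˡ-*; m%n<n)
open import Data.Integer using (+_; _-_) renaming (_*_ to _*ℤ_)
open import Data.Integer.Divisibility using (_∣_)
import Data.Integer as ℤ
import Data.Integer.Properties as ℤ
import Data.Integer.Divisibility.Signed as ℤ∣

+n≡+[n%3]+[n/3]*3 : ∀ n → + n ≡ + (n % 3) ℤ.+ + (n / 3) ℤ.* + 3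
+n≡+[n%3]+[n/3]*3 n = ≡.trans (≡.cong +_ (m≡m%n+[m/n]*n n 3))
                              (≡.trans (ℤ.pos-+ (n % 3) _) (≡.cong (ℤ._+_ (+ (n % 3))) (ℤ.pos-* (n / 3) 3)))

3∣x+y*3⇔3∣x : ∀ x y → (+ 3 ∣ x ℤ.+ y ℤ.* + 3) ⇔ (+ 3 ∣ x)
3∣x+y*3⇔3∣x x y = mk⇔
  (λ 3∣x+y*3 → ℤ∣.∣⇒∣ᵤ {+ 3} {x} (ℤ∣.∣m+n∣n⇒∣m (ℤ∣.∣ᵤ⇒∣ {+ 3} {x ℤ.+ y ℤ.* + 3} 3∣x+y*3) 3∣y*3))
  (λ 3∣x → ℤ∣.∣⇒∣ᵤ {+ 3} {x ℤ.+ y ℤ.* + 3} (ℤ∣.∣m∣n⇒∣m+n (ℤ∣.∣ᵤ⇒∣ {+ 3} {x} 3∣x) 3∣y*3))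
  where
  3∣y*3 : + 3 ℤ∣.∣ y ℤ.* + 3
  3∣y*3 = ℤ∣.∣n⇒∣m*n y ℤ∣.∣-refl

3∣m[l-m]⇔3∣r[s-r] : ∀ m l → (+ 3 ∣ + m *ℤ (+ l - + m)) ⇔ (+ 3 ∣ + (m % 3) *ℤ (+ (l % 3) - + (m % 3)))
3∣m[l-m]⇔3∣r[s-r] m l = ≡.subst (λ z → (+ 3 ∣ z) ⇔ (+ 3 ∣ r[s-r])) (≡.sym m[l-m]≡) (3∣x+y*3⇔3∣x r[s-r] w)
  where
  open import Data.Integer.Solver using (module +-*-Solver)
  open +-*-Solver
  expand : ∀ r a s b → (r ℤ.+ a ℤ.* + 3) ℤ.* ((s ℤ.+ b ℤ.* + 3) ℤ.- (r ℤ.+ a ℤ.* + 3))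
                     ≡ r ℤ.* (s ℤ.- r) ℤ.+ (r ℤ.* (b ℤ.- a) ℤ.+ a ℤ.* (s ℤ.- r) ℤ.+ a ℤ.* (b ℤ.- a) ℤ.* + 3) ℤ.* + 3
  expand = solve 4 (λ r a s b → (r :+ a :* con (+ 3)) :* ((s :+ b :* con (+ 3)) :- (r :+ a :* con (+ 3)))
                     := r :* (s :- r) :+ (r :* (b :- a) :+ a :* (s :- r) :+ a :* (b :- a) :* con (+ 3)) :* con (+ 3)) ≡.refl
  r a s b r[s-r] w : ℤ.ℤ
  r = + (m % 3)
  a = + (m / 3)
  s = + (l % 3)
  b = + (l / 3)
  r[s-r] = r *ℤ (s - r)
  w = r ℤ.* (b ℤ.- a) ℤ.+ a ℤ.* (s ℤ.- r) ℤ.+ a ℤ.* (b ℤ.- a) ℤ.* + 3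
  m[l-m]≡ : + m *ℤ (+ l - + m) ≡ r[s-r] ℤ.+ w ℤ.* + 3
  m[l-m]≡ = ≡.trans (≡.cong₂ (λ u v → u *ℤ (v - u)) (+n≡+[n%3]+[n/3]*3 m) (+n≡+[n%3]+[n/3]*3 l)) (expand r a s b)

residue-table : ∀ r s → r ℕ.< 3 → s ℕ.< 3 → s ≢ 0 → (+ 3 ∣ + r *ℤ (+ s - + r)) ⇔ ((r * s) % 3 ≢ 2)
residue-table _ 0 _ _ s≢0 = ⊥-elim (s≢0 ≡.refl)
residue-table 0 1 _ _ _ = mk⇔ (λ _ ()) (λ _ → ND.divides 0 ≡.refl)
residue-table 0 2 _ _ _ = mk⇔ (λ _ ()) (λ _ → ND.divides 0 ≡.refl)
residue-table 1 1 _ _ _ = mk⇔ (λ _ ()) (λ _ → ND.divides 0 ≡.refl)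
residue-table 2 2 _ _ _ = mk⇔ (λ _ ()) (λ _ → ND.divides 0 ≡.refl)
residue-table 1 2 _ _ _ = mk⇔ (⊥-elim ∘ ND.>⇒∤ (ℕ.s≤s (ℕ.s≤s ℕ.z≤n))) (λ ≢2 → ⊥-elim (≢2 ≡.refl))
residue-table 2 1 _ _ _ = mk⇔ (⊥-elim ∘ ND.>⇒∤ (ℕ.s≤s (ℕ.s≤s (ℕ.s≤s ℕ.z≤n)))) (λ ≢2 → ⊥-elim (≢2 ≡.refl))
residue-table (suc (suc (suc _))) _ (ℕ.s≤s (ℕ.s≤s (ℕ.s≤s ()))) _ _
residue-table _ (suc (suc (suc _))) _ (ℕ.s≤s (ℕ.s≤s (ℕ.s≤s ()))) _

l⊥3⇒l%3≢0 : ∀ {l} → Coprime l 3 → l % 3 ≢ 0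
l⊥3⇒l%3≢0 {l} l⊥3 l%3≡0 with l⊥3 (ND.m%n≡0⇒n∣m l 3 l%3≡0 , ND.∣-refl)
... | ()

-- Since 3 ∤ l: m(l - m) ≡ 0 (mod 3) iff m ≡ 0 or m ≡ l (mod 3), iff ml ≢ 2 (mod 3).
3∣m[l-m]⇔ml%3≢2 : ∀ m l → Coprime l 3 → (+ 3 ∣ + m *ℤ (+ l - + m)) ⇔ ((m * l) % 3 ≢ 2)
3∣m[l-m]⇔ml%3≢2 m l l⊥3 = ≡.subst (λ n → (+ 3 ∣ + m *ℤ (+ l - + m)) ⇔ n ≢ 2) (≡.sym (%-distribˡ-* m l 3))
  (⇔-trans (3∣m[l-m]⇔3∣r[s-r] m l) (residue-table (m % 3) (l % 3) (m%n<n m 3) (m%n<n l 3) (l⊥3⇒l%3≢0 l⊥3)))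

<3-≢2 : ∀ {r} → r ℕ.< 3 → r ≢ 2 → r ≡ 0 ⊎ r ≡ 1
<3-≢2 {0} _ _   = inj₁ ≡.refl
<3-≢2 {1} _ _   = inj₂ ≡.refl
<3-≢2 {2} _ r≢2 = ⊥-elim (r≢2 ≡.refl)
<3-≢2 {suc (suc (suc _))} (ℕ.s≤s (ℕ.s≤s (ℕ.s≤s ()))) _

3∣m⇒ml%3≡0 : ∀ m l → + 3 ∣ + m → (m * l) % 3 ≡ 0
3∣m⇒ml%3≡0 m l 3∣m = ND.n∣m⇒m%n≡0 (m * l) 3 (ND.∣m⇒∣m*n l 3∣m)

m≡l≢0⇒ml%3≡1 : ∀ m l → (l % 3 ≡ 1 × m % 3 ≡ 1) ⊎ (l % 3 ≡ 2 × m % 3 ≡ 2) → (m * l) % 3 ≡ 1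
m≡l≢0⇒ml%3≡1 m l (inj₁ (l≡1 , m≡1)) = ≡.trans (%-distribˡ-* m l 3) (≡.cong₂ (λ r s → (r * s) % 3) m≡1 l≡1)
m≡l≢0⇒ml%3≡1 m l (inj₂ (l≡2 , m≡2)) = ≡.trans (%-distribˡ-* m l 3) (≡.cong₂ (λ r s → (r * s) % 3) m≡2 l≡2)

corollary4p4 : ∀ {c ℓ' : Level} (l m : ℕ) → 1 ≤ l → 1 ≤ m → Coprime l 3 →
    (F : CommutativeRing c ℓ') → IsField F → HasCardinality F ((2 ^ m) ^ 3) →
    ((+ 3 ∣ (+ m) *ℤ ((+ l) - (+ m))) → HasExactly F (Γ F m l) 3)
    × (¬ (+ 3 ∣ (+ m) *ℤ ((+ l) - (+ m))) → HasExactly F (Γ F m l) 0)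
    × ((+ 3 ∣ + m) → ∀ x → Γ F m l x ⇔ RootA F x)
    × ((l % 3 ≡ 1 × m % 3 ≡ 1) ⊎ (l % 3 ≡ 2 × m % 3 ≡ 2) → ∀ x → Γ F m l x ⇔ RootB F x)
corollary4p4 l (suc m) _ _ l⊥3 F isField card =
    (λ 3∣ → [ (λ k≡0 → HasExactly-⇔ (Γ⇔RootA k≡0) RootA-has-3)
            , (λ k≡1 → HasExactly-⇔ (Γ⇔RootB k≡1) RootB-has-3)
            ] (<3-≢2 (m%n<n k 3) (Equivalence.to 3∣⇔k≢2 3∣)))
  , (λ 3∤ → HasExactly-∅ (¬Γ (Dec.decidable-stable (k % 3 ℕ.≟ 2) (3∤ ∘ Equivalence.from 3∣⇔k≢2))))
  , (λ 3∣m → Γ⇔RootA (3∣m⇒ml%3≡0 (suc m) l 3∣m))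
  , (λ m≡l → Γ⇔RootB (m≡l≢0⇒ml%3≡1 (suc m) l m≡l))
  where
  open Corollary F isField m l card
  open RingLemmas F using (HasExactly-⇔; HasExactly-∅)
  3∣⇔k≢2 : (+ 3 ∣ + suc m *ℤ (+ l - + suc m)) ⇔ (k % 3 ≢ 2)
  3∣⇔k≢2 = 3∣m[l-m]⇔ml%3≢2 (suc m) l l⊥3
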